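{- Let $k\geq 2$ be a constant and let $L$ be a regular language over the alphabet $\{0,1,\ldots,k-1\}$. Then a register machine with three registers can decide, in time linear in the number of $k$-ary digits of the input, whether the $k$-ary representation of a given input number belongs to $L$ (outputting $1$ if yes and $0$ if no). If $k$ is a power of two, two registers suffice.
   Context: Model (addition machine): a program is a finite list of numbered lines; the machine has finitely many registers, each holding an arbitrary integer. Allowed commands, each counting as one step: $x=y+z$, $x=y+c$, $x=y-z$, $x=y-c$, $x=c-y$, $x=c$ (registers $x,y,z$, integer constants $c$); "read $x$"/"write $x$" of a whole integer; conditionals "if $x\,R\,y$" and "if $x\,R\,c$" with $R\in\{<,=,>,\neq,\leq,\geq\}$; "goto $\ell$". Finitely many variables with a fixed finite range of values may also be used and do not count as registers. Running time is the number of executed commands. -}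

module Defs where

open import Data.Nat as ℕ using (ℕ; zero; suc; _≤_; _<_; _^_; _<ᵇ_; s≤s; z≤n)
open import Data.Nat.DivMod using (_/_; _%_; m%n<n)
open import Data.Nat.Properties using (≤-trans)
open import Data.Integer as ℤ using (ℤ; +_; _+_; _-_)
open import Data.Fin as Fin using (Fin; fromℕ<)
open import Data.List using (List; []; _∷_; _++_; [_]; length)
open import Data.Maybe using (Maybe; just; nothing; _>>=_)
open import Data.Bool using (Bool; true; false; if_then_else_)
open import Data.Product using (Σ; Σ-syntax; ∃; ∃-syntax; _×_; _,_)
open import Relation.Nullary using (¬_; does)
open import Relation.Binary.PropositionalEquality using (_≡_)
open import Function.Bundles using (_⇔_)

data Rel : Set where
  lt eq gt ne le ge : Rel

evalRel : Rel → ℤ → ℤ → Bool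
evalRel lt x y = does (x ℤ.<? y)
evalRel eq x y = does (x ℤ.≟ y)
evalRel gt x y = does (y ℤ.<? x)
evalRel ne x y = Data.Bool.not (does (x ℤ.≟ y))
  where import Data.Bool
evalRel le x y = does (x ℤ.≤? y)
evalRel ge x y = does (y ℤ.≤? x)

-- Commands of a program with r registers (Fin r) and a finite-range
-- control variable with values in Fin m (a tuple of finitely many
-- finite-range variables is a single finite-range variable).
-- Line numbers (goto targets) are natural numbers, lines numbered from 0.
data Instr (r m : ℕ) : Set where
  add   : (x y z : Fin r) → Instr r m
  addc  : (x y : Fin r) → ℤ → Instr r m
  sub   : (x y z : Fin r) → Instr r m
  subc  : (x y : Fin r) → ℤ → Instr r m
  csub  : (x : Fin r) → ℤ → Fin r → Instr r m
  const : (x : Fin r) → ℤ → Instr r m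
  read  : (x : Fin r) → Instr r m
  write : (x : Fin r) → Instr r m
  ifr   : (x : Fin r) → Rel → (y : Fin r) → (ℓ : ℕ) → Instr r m
  ifc   : (x : Fin r) → Rel → ℤ → (ℓ : ℕ) → Instr r m
  goto  : (ℓ : ℕ) → Instr r m
  fset  : (Fin m → Fin m) → Instr r m
  fif   : (Fin m → Bool) → (ℓ : ℕ) → Instr r m

Program : ℕ → ℕ → Set
Program r m = List (Instr r m)

record Config (r m : ℕ) : Set where
  constructor cfg
  field
    pc     : ℕ
    regs   : Fin r → ℤ
    fvar   : Fin m
    input  : List ℤ
    output : List ℤ
open Config public

nth : {A : Set} → List A → ℕ → Maybe A
nth []       _       = nothing
nth (a ∷ as) zero    = just a
nth (a ∷ as) (suc n) = nth as n

setReg : {r : ℕ} → (Fin r → ℤ) → Fin r → ℤ → (Fin r → ℤ)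
setReg f i v j = if does (i Fin.≟ j) then v else f j

-- one step; nothing if halted (pc outside the program) or stuck
-- (reading from an exhausted input)
step : {r m : ℕ} → Program r m → Config r m → Maybe (Config r m)
step P (cfg pc R u inp out) with nth P pc
... | nothing = nothing
... | just (add x y z)   = just (cfg (suc pc) (setReg R x (R y + R z)) u inp out)
... | just (addc x y c)  = just (cfg (suc pc) (setReg R x (R y + c)) u inp out)
... | just (sub x y z)   = just (cfg (suc pc) (setReg R x (R y - R z)) u inp out)
... | just (subc x y c)  = just (cfg (suc pc) (setReg R x (R y - c)) u inp out)
... | just (csub x c y)  = just (cfg (suc pc) (setReg R x (c - R y)) u inp out)
... | just (const x c)   = just (cfg (suc pc) (setReg R x c) u inp out)
... | just (read x) with inp
...   | []      = nothing
...   | v ∷ vs  = just (cfg (suc pc) (setReg R x v) u vs out)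
step P (cfg pc R u inp out) | just (write x) =
  just (cfg (suc pc) R u inp (out ++ [ R x ]))
step P (cfg pc R u inp out) | just (ifr x ρ y ℓ) =
  just (cfg (if evalRel ρ (R x) (R y) then ℓ else suc pc) R u inp out)
step P (cfg pc R u inp out) | just (ifc x ρ c ℓ) =
  just (cfg (if evalRel ρ (R x) c then ℓ else suc pc) R u inp out)
step P (cfg pc R u inp out) | just (goto ℓ) = just (cfg ℓ R u inp out)
step P (cfg pc R u inp out) | just (fset f) = just (cfg (suc pc) R (f u) inp out)
step P (cfg pc R u inp out) | just (fif p ℓ) =
  just (cfg (if p u then ℓ else suc pc) R u inp out)

exec : {r m : ℕ} → Program r m → ℕ → Config r m → Maybe (Config r m)
exec P zero    c = just c
exec P (suc t) c = step P c >>= exec P t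

Halted : {r m : ℕ} → Program r m → Config r m → Set
Halted P c = nth P (pc c) ≡ nothing

initial : {r m : ℕ} → ℤ → Config r (suc m)
initial a = cfg 0 (λ _ → + 0) Fin.zero (a ∷ []) []

HaltsWith : {r m : ℕ} → Program r (suc m) → ℤ → ℕ → List ℤ → Set
HaltsWith P a t out =
  Σ[ c ∈ Config _ _ ] (exec P t (initial a) ≡ just c × Halted P c × output c ≡ out)

-- k-ary digits of n, most significant first, without leading zeros;
-- the number 0 is represented by the single digit 0.
-- (fuel argument: suc n suffices since n / k < n for n ≥ k ≥ 2)
kary : (k : ℕ) → 2 ≤ k → ℕ → List (Fin k)
kary (suc k′) _ n = go (suc n) n
  where
  k = suc k′
  digit : ℕ → Fin k
  digit m = fromℕ< (m%n<n m k)
  go : ℕ → ℕ → List (Fin k)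
  go zero    m = []
  go (suc f) m = if m <ᵇ k then [ digit m ] else (go f (m / k) ++ [ digit m ])

record DFA (k : ℕ) : Set where
  field
    states : ℕ
    start  : Fin states
    δ      : Fin states → Fin k → Fin states
    final  : Fin states → Bool
open DFA public

run : {k : ℕ} (D : DFA k) → Fin (states D) → List (Fin k) → Fin (states D)
run D q []       = q
run D q (a ∷ w)  = run D (δ D q a) w

Accepts : {k : ℕ} → DFA k → List (Fin k) → Set
Accepts D w = final D (run D (start D) w) ≡ true

Regular : {k : ℕ} → (List (Fin k) → Set) → Set
Regular {k} L = Σ[ D ∈ DFA k ] (∀ w → L w ⇔ Accepts D w)

DecidesLinear : (r k : ℕ) → 2 ≤ k → (List (Fin k) → Set) → Set
DecidesLinear r k h L =
  Σ[ m ∈ ℕ ] Σ[ P ∈ Program r (suc m) ] Σ[ C ∈ ℕ ] ∀ (n : ℕ) →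
    Σ[ t ∈ ℕ ] Σ[ out ∈ List ℤ ]
      ( t ≤ C ℕ.* length (kary k h n)
      × HaltsWith P (+ n) t out
      × (L (kary k h n) → out ≡ (+ 1) ∷ [])
      × (¬ L (kary k h n) → out ≡ (+ 0) ∷ []) )

IsPowerOfTwo : ℕ → Set
IsPowerOfTwo k = Σ[ j ∈ ℕ ] k ≡ 2 ^ j

-- The machine computes X = k n + 1 (the digits of n followed by a marker
-- digit 1) and Y = k^(d+1), where d is the number of digits, multiplying by
-- the constant k as it goes.  It then repeatedly multiplies X by k; the
-- leading digit of the result is ⌊X / Y⌋ < k, which is read off by at most
-- k − 1 subtractions of Y counted in a finite-range variable and fed to the
-- automaton, whose state lives in the same finite-range variable.  X = Y
-- signals that only the marker is left.  Every digit costs O(k) steps.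
-- Multiplying by k takes k − 1 additions of a copy kept in a third register;
-- when k = 2^K it takes K doublings in place, so two registers suffice.

module Submission where

open import Defs
open import Data.Nat
open import Data.Nat.Properties
open import Data.Nat.DivMod using (_/_; _%_; m%n<n; m≡m%n+[m/n]*n; m<n⇒m%n≡m; m/n<m; m<n*o⇒m/o<n)
open import Data.Nat.Tactic.RingSolver using (solve-∀)
open import Data.Fin as Fin using (Fin; zero; suc; fromℕ<; toℕ)
open import Data.Fin.Properties using (toℕ-fromℕ<; toℕ<n; toℕ-injective; remQuot-combine)
open import Data.List using (List; []; _∷_; _++_; _∷ʳ_; [_]; length; drop)
open import Data.Maybe using (just; nothing; _>>=_)
open import Data.List.Properties using (length-++)
open import Data.Bool using (Bool; true; false; if_then_else_)
open import Data.Integer as ℤ using (ℤ; +_)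
import Data.Integer.Properties as ℤ
open import Data.Product using (_×_; _,_; proj₁; proj₂; Σ-syntax)
open import Data.Sum using (_⊎_; inj₁; inj₂)
open import Relation.Nullary using (¬_; contradiction; does)
open import Relation.Nullary.Reflects using (ofʸ; ofⁿ)
open import Relation.Nullary.Decidable using (dec-true; dec-false)
open import Function using (_∘_; id)
open import Function.Bundles using (_⇔_; Equivalence)
open import Relation.Binary.PropositionalEquality
  using (_≡_; _≢_; refl; sym; trans; cong; cong₂; subst; module ≡-Reasoning)

module _ {k : ℕ} where

  value : List (Fin k) → ℕ
  value []      = 0
  value (a ∷ v) = toℕ a * k ^ length v + value v

  value-< : ∀ v → value v < k ^ length v
  value-< []      = s≤s z≤n
  value-< (a ∷ v) = begin-strict
    toℕ a * K + value v  <⟨ +-monoʳ-< (toℕ a * K) (value-< v) ⟩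
    toℕ a * K + K        ≡⟨ +-comm (toℕ a * K) K ⟩
    suc (toℕ a) * K      ≤⟨ *-monoˡ-≤ K (toℕ<n a) ⟩
    k * K                ∎
    where
    open ≤-Reasoning
    K = k ^ length v

  length-∷ʳ : ∀ (v : List (Fin k)) a → length (v ∷ʳ a) ≡ suc (length v)
  length-∷ʳ v a = trans (length-++ v) (+-comm (length v) 1)

  value-∷ʳ : ∀ v a → value (v ∷ʳ a) ≡ value v * k + toℕ a
  value-∷ʳ []      a = trans (+-identityʳ _) (*-identityʳ (toℕ a))
  value-∷ʳ (b ∷ v) a rewrite length-∷ʳ v a | value-∷ʳ v a =
    horner (toℕ b) (k ^ length v) (value v) k (toℕ a)
    where
    horner : ∀ b K V k a → b * (k * K) + (V * k + a) ≡ (b * K + V) * k + a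
    horner = solve-∀

-- `kary` recurses through a fuel-indexed function local to its `where`
-- block, which cannot be named; `karyGo` is that function, obtained as the
-- solution of a metavariable pinned down by the unification problem below.
mutual
  karyGo : (k′ : ℕ) → 2 ≤ suc k′ → ℕ → ℕ → ℕ → List (Fin (suc k′))
  karyGo = _

  private
    karyGo-pin : ∀ k′ h n → kary (suc k′) h (suc n) ≡ kary (suc k′) h (suc n)
    karyGo-pin k′ h n with suc n
    ... | p with p / suc k′ / suc k′
    ... | q = cong (λ t → if n <ᵇ k′ then [ digit p ]
                          else ((if p / suc k′ <ᵇ suc k′ then [ digit (p / suc k′) ]
                                 else (t ++ [ digit (p / suc k′) ])) ++ [ digit p ]))
                   (refl {x = karyGo k′ h p n q})
      where
      digit : ℕ → Fin (suc k′)
      digit m = fromℕ< (m%n<n m (suc k′))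

module _ {k′ : ℕ} {h : 2 ≤ suc k′} {p : ℕ} where
  private
    k : ℕ
    k = suc k′

    digit : ℕ → Fin k
    digit m = fromℕ< (m%n<n m k)

    quotient-< : ∀ {f m} → k ≤ m → m < suc f → m / k < f
    quotient-< {m = m} k≤m m≤f = <-≤-trans (m/n<m m k {{>-nonZero (<-≤-trans z<s k≤m)}} h) (s≤s⁻¹ m≤f)

  karyGo-suc : ∀ f m → (m < k × karyGo k′ h p (suc f) m ≡ [ digit m ])
                     ⊎ (k ≤ m × karyGo k′ h p (suc f) m ≡ karyGo k′ h p f (m / k) ∷ʳ digit m)
  karyGo-suc f m with m <ᵇ k | <ᵇ-reflects-< m k
  ... | true  | ofʸ m<k = inj₁ (m<k , refl)
  ... | false | ofⁿ m≮k = inj₂ (≮⇒≥ m≮k , refl)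

  value-karyGo : ∀ f m → m < f → value (karyGo k′ h p f m) ≡ m
  value-karyGo (suc f) m m≤f with karyGo-suc f m
  ... | inj₁ (m<k , unfold) rewrite unfold =
    trans (value-∷ʳ [] (digit m)) (trans (toℕ-fromℕ< _) (m<n⇒m%n≡m m<k))
  ... | inj₂ (k≤m , unfold) rewrite unfold = begin
    value (karyGo k′ h p f (m / k) ∷ʳ digit m)      ≡⟨ value-∷ʳ (karyGo k′ h p f (m / k)) (digit m) ⟩
    value (karyGo k′ h p f (m / k)) * k + toℕ (digit m)
      ≡⟨ cong₂ (λ q r → q * k + r) (value-karyGo f (m / k) (quotient-< k≤m m≤f)) (toℕ-fromℕ< _) ⟩
    m / k * k + m % k                                ≡⟨ +-comm (m % k) (m / k * k) ⟨
    m % k + m / k * k                                ≡⟨ m≡m%n+[m/n]*n m k ⟨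
    m                                                ∎
    where open ≡-Reasoning

  length-karyGo-positive : ∀ f m → 1 ≤ length (karyGo k′ h p (suc f) m)
  length-karyGo-positive f m with karyGo-suc f m
  ... | inj₁ (_ , unfold) rewrite unfold = s≤s z≤n
  ... | inj₂ (_ , unfold) rewrite unfold | length-∷ʳ (karyGo k′ h p f (m / k)) (digit m) = s≤s z≤n

  length-karyGo-minimal : ∀ f m e → m < f → 1 ≤ e → m < k ^ e → length (karyGo k′ h p f m) ≤ e
  length-karyGo-minimal (suc f) m e m≤f 1≤e m<kᵉ with karyGo-suc f m
  ... | inj₁ (_ , unfold) rewrite unfold = 1≤e
  ... | inj₂ (k≤m , unfold) rewrite unfold | length-∷ʳ (karyGo k′ h p f (m / k)) (digit m) with e
  ...   | suc zero = contradiction (subst (m <_) (*-identityʳ k) m<kᵉ) (≤⇒≯ k≤m)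
  ...   | suc (suc e′) = s≤s (length-karyGo-minimal f (m / k) (suc e′) (quotient-< k≤m m≤f) (s≤s z≤n) m/k<kᵉ)
    where
    m/k<kᵉ : m / k < k ^ suc e′
    m/k<kᵉ = m<n*o⇒m/o<n (subst (m <_) (*-comm k (k ^ suc e′)) m<kᵉ)

-- `marked v i` is the value of the digit string v, then a digit 1, then i
-- digits 0; the trailing 1 lets the machine detect when v is used up.
module _ {k : ℕ} where

  marked : List (Fin k) → ℕ → ℕ
  marked v i = value v * k ^ suc i + k ^ i

  marked-< : 1 < k → ∀ v i → marked v i < k ^ (length v + suc i)
  marked-< 1<k v i = begin-strict
    value v * K + k ^ i       <⟨ +-monoʳ-< (value v * K) (^-monoʳ-< k 1<k (n<1+n i)) ⟩
    value v * K + K           ≡⟨ +-comm (value v * K) K ⟩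
    suc (value v) * K         ≤⟨ *-monoˡ-≤ K (value-< v) ⟩
    k ^ length v * K          ≡⟨ ^-distribˡ-+-* k (length v) (suc i) ⟨
    k ^ (length v + suc i)    ∎
    where
    open ≤-Reasoning
    K = k ^ suc i

  *-marked-∷ : ∀ a v i → k * marked (a ∷ v) i ≡ toℕ a * k ^ (length v + suc (suc i)) + marked v (suc i)
  *-marked-∷ a v i = begin
    k * marked (a ∷ v) i
      ≡⟨ shift k (toℕ a) (k ^ length v) (value v) (k ^ i) ⟩
    toℕ a * (k ^ length v * k ^ suc (suc i)) + marked v (suc i)
      ≡⟨ cong (λ p → toℕ a * p + marked v (suc i)) (^-distribˡ-+-* k (length v) (suc (suc i))) ⟨
    toℕ a * k ^ (length v + suc (suc i)) + marked v (suc i)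
      ∎
    where
    open ≡-Reasoning
    shift : ∀ k a L V K → k * ((a * L + V) * (k * K) + K) ≡ a * (L * (k * (k * K))) + (V * (k * (k * K)) + k * K)
    shift = solve-∀

m*n+o≢n : ∀ a {P x} → 0 < x → x < P → a * P + x ≢ P
m*n+o≢n zero    0<x x<P x≡P = <⇒≢ x<P x≡P
m*n+o≢n (suc a) {P} {x} 0<x x<P ≡P = <⇒≢ P<P+a*P+x (sym (trans (sym (+-assoc P (a * P) x)) ≡P))
  where
  P<P+a*P+x : P < P + (a * P + x)
  P<P+a*P+x = subst (_< P + (a * P + x)) (+-identityʳ P) (+-monoʳ-< P (<-≤-trans 0<x (m≤n+m x (a * P))))

module _ {k′ : ℕ} (h : 2 ≤ suc k′) (n : ℕ) where

  value-kary : value (kary (suc k′) h n) ≡ n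
  value-kary = value-karyGo (suc n) n ≤-refl

  length-kary-positive : 1 ≤ length (kary (suc k′) h n)
  length-kary-positive = length-karyGo-positive n n

  length-kary-minimal : ∀ e → 1 ≤ e → n < suc k′ ^ e → length (kary (suc k′) h n) ≤ e
  length-kary-minimal e = length-karyGo-minimal (suc n) n e ≤-refl

n<2^n : ∀ n → n < 2 ^ n
n<2^n zero    = s≤s z≤n
n<2^n (suc n) = +-mono-≤ (m^n>0 2 n) (≤-trans (n<2^n n) (m≤m+n (2 ^ n) 0))

module Runs {r m : ℕ} (P : Program r m) where

  Reach : Config r m → ℕ → (Config r m → Set) → Set
  Reach c B Q = Σ[ t ∈ ℕ ] Σ[ c′ ∈ Config r m ] (t ≤ B × exec P t c ≡ just c′ × Q c′)

  exec-+ : ∀ s t c → exec P (s + t) c ≡ (exec P s c >>= exec P t)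
  exec-+ zero    t c = refl
  exec-+ (suc s) t c with step P c
  ... | nothing = refl
  ... | just c′ = exec-+ s t c′

  private variable
    c c′ : Config r m
    B B′ : ℕ
    Q Q′ : Config r m → Set

  stay : Q c → Reach c 0 Q
  stay {c = c} q = 0 , c , z≤n , refl , q

  infixr 5 _⟫_
  _⟫_ : step P c ≡ just c′ → Reach c′ B Q → Reach c (suc B) Q
  _⟫_ {c = c} steps (t , c″ , t≤B , runs , q) = suc t , c″ , s≤s t≤B , runs′ , q
    where
    runs′ : (step P c >>= exec P t) ≡ just c″
    runs′ rewrite steps = runs

  infixr 4 _⨾_
  _⨾_ : Reach c B Q → (∀ {c′} → Q c′ → Reach c′ B′ Q′) → Reach c (B + B′) Q′
  _⨾_ {c = c} (s , c₁ , s≤B , runs₁ , q) k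
    with t , c₂ , t≤B′ , runs₂ , q′ ← k q =
    s + t , c₂ , +-mono-≤ s≤B t≤B′ , trans (exec-+ s t c) runs , q′
    where
    runs : (exec P s c >>= exec P t) ≡ just c₂
    runs rewrite runs₁ = runs₂

  Reach-weaken : B ≤ B′ → Reach c B Q → Reach c B′ Q
  Reach-weaken B≤B′ (t , c′ , t≤B , runs , q) = t , c′ , ≤-trans t≤B B≤B′ , runs , q

  Reach-map : (∀ {c} → Q c → Q′ c) → Reach c B Q → Reach c B Q′
  Reach-map f (t , c′ , t≤B , runs , q) = t , c′ , t≤B , runs , f q

  record At (ℓ : ℕ) (Rg : (Fin r → ℤ) → Set) (F : Fin m → Set) (o : List ℤ) (c : Config r m) : Set where
    constructor mkAt
    field
      at-line     : pc c ≡ ℓ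
      at-regs     : Rg (regs c)
      at-control  : F (fvar c)
      at-input    : input c ≡ []
      at-output   : output c ≡ o

  private variable
    ℓ ℓ′ : ℕ
    x y z : Fin r
    v : ℤ
    b : Bool
    o : List ℤ
    Rg Rg′ : (Fin r → ℤ) → Set
    F F′ : Fin m → Set

  At-map : (∀ {R} → Rg R → Rg′ R) → (∀ {w} → F w → F′ w) → At ℓ Rg F o c → At ℓ Rg′ F′ o c
  At-map f g (mkAt l rg fu i o) = mkAt l (f rg) (g fu) i o

  add-step : nth P ℓ ≡ just (add x y z) → (∀ {R} → Rg R → Rg′ (setReg R x (R y ℤ.+ R z))) →
             At ℓ Rg F o c → Reach c 1 (At (suc ℓ) Rg′ F o)
  add-step {ℓ} {x} {y} {z} {o = o} {c = cfg _ R u _ _} fetch post (mkAt refl rg fu refl refl) =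
    steps ⟫ stay (mkAt refl (post rg) fu refl refl)
    where
    steps : step P (cfg ℓ R u [] o) ≡ just (cfg (suc ℓ) (setReg R x (R y ℤ.+ R z)) u [] o)
    steps rewrite fetch = refl

  addc-step : nth P ℓ ≡ just (addc x y v) → (∀ {R} → Rg R → Rg′ (setReg R x (R y ℤ.+ v))) →
              At ℓ Rg F o c → Reach c 1 (At (suc ℓ) Rg′ F o)
  addc-step {ℓ} {x} {y} {v} {o = o} {c = cfg _ R u _ _} fetch post (mkAt refl rg fu refl refl) =
    steps ⟫ stay (mkAt refl (post rg) fu refl refl)
    where
    steps : step P (cfg ℓ R u [] o) ≡ just (cfg (suc ℓ) (setReg R x (R y ℤ.+ v)) u [] o)
    steps rewrite fetch = refl

  sub-step : nth P ℓ ≡ just (sub x y z) → (∀ {R} → Rg R → Rg′ (setReg R x (R y ℤ.- R z))) →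
             At ℓ Rg F o c → Reach c 1 (At (suc ℓ) Rg′ F o)
  sub-step {ℓ} {x} {y} {z} {o = o} {c = cfg _ R u _ _} fetch post (mkAt refl rg fu refl refl) =
    steps ⟫ stay (mkAt refl (post rg) fu refl refl)
    where
    steps : step P (cfg ℓ R u [] o) ≡ just (cfg (suc ℓ) (setReg R x (R y ℤ.- R z)) u [] o)
    steps rewrite fetch = refl

  const-step : nth P ℓ ≡ just (const x v) → (∀ {R} → Rg R → Rg′ (setReg R x v)) →
               At ℓ Rg F o c → Reach c 1 (At (suc ℓ) Rg′ F o)
  const-step {ℓ} {x} {v} {o = o} {c = cfg _ R u _ _} fetch post (mkAt refl rg fu refl refl) =
    steps ⟫ stay (mkAt refl (post rg) fu refl refl)
    where
    steps : step P (cfg ℓ R u [] o) ≡ just (cfg (suc ℓ) (setReg R x v) u [] o)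
    steps rewrite fetch = refl

  write-step : nth P ℓ ≡ just (write x) → (∀ {R} → Rg R → R x ≡ v) →
               At ℓ Rg F o c → Reach c 1 (At (suc ℓ) Rg F (o ++ [ v ]))
  write-step {ℓ} {x} {o = o} {c = cfg _ R u _ _} fetch value (mkAt refl rg fu refl refl) =
    steps ⟫ stay (mkAt refl rg fu refl (cong (λ w → o ++ [ w ]) (value rg)))
    where
    steps : step P (cfg ℓ R u [] o) ≡ just (cfg (suc ℓ) R u [] (o ++ [ R x ]))
    steps rewrite fetch = refl

  goto-step : nth P ℓ ≡ just (goto ℓ′) → At ℓ Rg F o c → Reach c 1 (At ℓ′ Rg F o)
  goto-step {ℓ} {ℓ′} {o = o} {c = cfg _ R u _ _} fetch (mkAt refl rg fu refl refl) =
    steps ⟫ stay (mkAt refl rg fu refl refl)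
    where
    steps : step P (cfg ℓ R u [] o) ≡ just (cfg ℓ′ R u [] o)
    steps rewrite fetch = refl

  ifr-step : ∀ {ρ} → nth P ℓ ≡ just (ifr x ρ y ℓ′) → (∀ {R} → Rg R → evalRel ρ (R x) (R y) ≡ b) →
             At ℓ Rg F o c → Reach c 1 (At (if b then ℓ′ else suc ℓ) Rg F o)
  ifr-step {ℓ = ℓ} {x = x} {y = y} {ℓ′ = ℓ′} {b = b} {o = o} {c = cfg _ R u _ _} fetch test (mkAt refl rg fu refl refl) =
    steps ⟫ stay (mkAt refl rg fu refl refl)
    where
    steps : step P (cfg ℓ R u [] o) ≡ just (cfg (if b then ℓ′ else suc ℓ) R u [] o)
    steps rewrite fetch | test rg = refl

  fset-step : ∀ {f} → nth P ℓ ≡ just (fset f) → (∀ {w} → F w → F′ (f w)) →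
              At ℓ Rg F o c → Reach c 1 (At (suc ℓ) Rg F′ o)
  fset-step {ℓ = ℓ} {o = o} {c = cfg _ R u _ _} {f = f} fetch post (mkAt refl rg fu refl refl) =
    steps ⟫ stay (mkAt refl rg (post fu) refl refl)
    where
    steps : step P (cfg ℓ R u [] o) ≡ just (cfg (suc ℓ) R (f u) [] o)
    steps rewrite fetch = refl

  fif-step : ∀ {p} → nth P ℓ ≡ just (fif p ℓ′) → (∀ {w} → F w → p w ≡ b) →
             At ℓ Rg F o c → Reach c 1 (At (if b then ℓ′ else suc ℓ) Rg F o)
  fif-step {ℓ = ℓ} {ℓ′ = ℓ′} {b = b} {o = o} {c = cfg _ R u _ _} fetch test (mkAt refl rg fu refl refl) =
    steps ⟫ stay (mkAt refl rg fu refl refl)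
    where
    steps : step P (cfg ℓ R u [] o) ≡ just (cfg (if b then ℓ′ else suc ℓ) R u [] o)
    steps rewrite fetch | test fu = refl

setReg-same : ∀ {r} (R : Fin r → ℤ) x v → setReg R x v x ≡ v
setReg-same R x v rewrite dec-true (x Fin.≟ x) refl = refl

setReg-other : ∀ {r} (R : Fin r → ℤ) {x y} v → x ≢ y → setReg R x v y ≡ R y
setReg-other R {x} {y} v x≢y rewrite dec-false (x Fin.≟ y) x≢y = refl

record Contains {r m} (P : Program r m) (ℓ : ℕ) (F : Program r m) : Set where
  constructor _,_
  field
    rest    : Program r m
    splits  : drop ℓ P ≡ F ++ rest

module _ {A : Set} where

  nth-drop : ∀ (xs : List A) ℓ i → nth (drop ℓ xs) i ≡ nth xs (i + ℓ)
  nth-drop []       zero    i = refl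
  nth-drop []       (suc ℓ) i = refl
  nth-drop (x ∷ xs) zero    i = cong (nth (x ∷ xs)) (sym (+-identityʳ i))
  nth-drop (x ∷ xs) (suc ℓ) i rewrite +-suc i ℓ = nth-drop xs ℓ i

  nth-++ : ∀ (xs ys : List A) i {a} → nth xs i ≡ just a → nth (xs ++ ys) i ≡ just a
  nth-++ (x ∷ xs) ys zero    found = found
  nth-++ (x ∷ xs) ys (suc i) found = nth-++ xs ys i found

nth-Contains : ∀ {r m} {P F : Program r m} {ℓ} i {ins} → Contains P ℓ F → nth F i ≡ just ins → nth P (i + ℓ) ≡ just ins
nth-Contains {P = P} {F} {ℓ} i (rest , P≡) found =
  trans (sym (nth-drop P ℓ i)) (trans (cong (λ xs → nth xs i) P≡) (nth-++ F rest i found))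

infix 4 _↦_∧_↦_
record _↦_∧_↦_ {r} (A : Fin r) (a : ℕ) (B : Fin r) (b : ℕ) (R : Fin r → ℤ) : Set where
  constructor _,_
  field
    holds₁ : R A ≡ + a
    holds₂ : R B ≡ + b

↦-swap : ∀ {r} {A B : Fin r} {a b R} → (A ↦ a ∧ B ↦ b) R → (B ↦ b ∧ A ↦ a) R
↦-swap (rA , rB) = rB , rA

-- A control value in Fin (S * k) is read as a pair: an automaton state in
-- Fin S and a digit counter in Fin k.
module Control (S k′ : ℕ) where

  k : ℕ
  k = suc k′

  state : Fin (S * k) → Fin S
  state = Fin.quotient {S} k

  counter : Fin (S * k) → Fin k
  counter = Fin.remainder {S} k

  state-combine : ∀ q j → state (Fin.combine q j) ≡ q
  state-combine q j = cong proj₁ (remQuot-combine {S} {k} q j)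

  counter-combine : ∀ q j → counter (Fin.combine q j) ≡ j
  counter-combine q j = cong proj₂ (remQuot-combine {S} {k} q j)

  record InState (q : Fin S) (w : Fin (S * k)) : Set where
    constructor inState
    field
      state≡ : state w ≡ q

  record Counting (q : Fin S) (j : ℕ) (w : Fin (S * k)) : Set where
    constructor counting
    field
      counting-state : state w ≡ q
      count          : toℕ (counter w) ≡ j

  resetCounter : Fin (S * k) → Fin (S * k)
  resetCounter w = Fin.combine (state w) Fin.zero

  incCounter : Fin (S * k) → Fin (S * k)
  incCounter w = Fin.combine (state w) (fromℕ< (m%n<n (suc (toℕ (counter w))) k))

  counterIs : ℕ → Fin (S * k) → Bool
  counterIs K w = does (toℕ (counter w) ≟ K)

  private variable
    q : Fin S
    j K : ℕ
    w : Fin (S * k)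

  resetCounter-Counting : InState q w → Counting q 0 (resetCounter w)
  resetCounter-Counting {w = w} (inState refl) =
    counting (state-combine (state w) Fin.zero) (cong toℕ (counter-combine (state w) Fin.zero))

  incCounter-Counting : suc j < k → Counting q j w → Counting q (suc j) (incCounter w)
  incCounter-Counting {w = w} sj<k (counting refl refl) =
    counting (state-combine (state w) _)
             (trans (cong toℕ (counter-combine (state w) _)) (trans (toℕ-fromℕ< _) (m<n⇒m%n≡m sj<k)))

  counterIs-true : Counting q K w → counterIs K w ≡ true
  counterIs-true {K = K} (counting _ refl) = dec-true (K ≟ K) refl

  counterIs-false : j ≢ K → Counting q j w → counterIs K w ≡ false
  counterIs-false {j} {K} j≢K (counting _ refl) = dec-false (j ≟ K) j≢K

  Counting⇒InState : Counting q j w → InState q w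
  Counting⇒InState (counting s≡q _) = inState s≡q

module Scaling (S k′ : ℕ) {r : ℕ} where
  open Control S k′

  scaleBlock : Fin r → Fin r → ℕ → ℕ → Program r (S * k)
  scaleBlock A T K ℓ =
    addc T A (+ 0) ∷ fset resetCounter ∷
    add A A T ∷ fset incCounter ∷ fif (counterIs K) (6 + ℓ) ∷ goto (2 + ℓ) ∷ []

  Scales : (A B T : Fin r) → ℕ → Set
  Scales A B T K =
    ∀ {P ℓ a b q o c} → Contains P ℓ (scaleBlock A T K ℓ) →
    Runs.At P ℓ (A ↦ a ∧ B ↦ b) (InState q) o c →
    Runs.Reach P c (4 * k) (Runs.At P (6 + ℓ) (A ↦ k * a ∧ B ↦ b) (InState q) o)

  module _ {A B T : Fin r} (Inv : ℕ → ℕ → ℕ → (Fin r → ℤ) → Set)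
           (body : ∀ a b j {R} → Inv a b j R → Inv a b (suc j) (setReg R A (R A ℤ.+ R T))) where

    scaleBlock-loop : ∀ {P ℓ a b q o c} m j {K} → K < k → Contains P ℓ (scaleBlock A T K ℓ) → m + suc j ≡ K →
      Runs.At P (2 + ℓ) (Inv a b j) (Counting q j) o c →
      Runs.Reach P c (3 + m * 4) (Runs.At P (6 + ℓ) (Inv a b K) (InState q) o)
    scaleBlock-loop {P} {a = a} {b} zero j K<k contains refl now =
      add-step (nth-Contains 2 contains refl) (body a b j) now ⨾ λ now →
      fset-step (nth-Contains 3 contains refl) (incCounter-Counting K<k) now ⨾ λ now →
      fif-step (nth-Contains 4 contains refl) counterIs-true now ⨾ λ now →
      stay (At-map id Counting⇒InState now)
      where open Runs P
    scaleBlock-loop {P} {a = a} {b} (suc m) j {K} K<k contains m+j≡K now =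
      add-step (nth-Contains 2 contains refl) (body a b j) now ⨾ λ now →
      fset-step (nth-Contains 3 contains refl) (incCounter-Counting sj<k) now ⨾ λ now →
      fif-step (nth-Contains 4 contains refl) (counterIs-false sj≢K) now ⨾ λ now →
      goto-step (nth-Contains 5 contains refl) now ⨾ λ now →
      scaleBlock-loop m (suc j) K<k contains (trans (+-suc m (suc j)) m+j≡K) now
      where
      open Runs P
      sj<K : suc j < K
      sj<K = subst (suc j <_) m+j≡K (s≤s (m≤n+m (suc j) m))
      sj<k : suc j < k
      sj<k = <-trans sj<K K<k
      sj≢K : suc j ≢ K
      sj≢K = <⇒≢ sj<K

    scaleBlock-correct :
      ∀ {K} → 1 ≤ K → K < k →
      (∀ {a b R} → (A ↦ a ∧ B ↦ b) R → Inv a b 0 (setReg R T (R A ℤ.+ + 0))) →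
      (∀ {a b R} → Inv a b K R → (A ↦ k * a ∧ B ↦ b) R) →
      Scales A B T K
    scaleBlock-correct {suc K′} _ K<k init exit {P} {a = a} {b} {q} contains now =
      Reach-weaken (bound K<k) (
      addc-step (nth-Contains 0 contains refl) init now ⨾ λ now →
      fset-step (nth-Contains 1 contains refl) resetCounter-Counting now ⨾ λ now →
      Reach-map (At-map (exit {a} {b}) id)
        (scaleBlock-loop {q = q} K′ 0 K<k contains (+-comm K′ 1) now))
      where
      open Runs P
      bound : suc K′ < k → 1 + (1 + (3 + K′ * 4)) ≤ 4 * k
      bound (s≤s K′<k′) = begin
        1 + suc K′ * 4  ≤⟨ +-monoʳ-≤ 1 (*-monoˡ-≤ 4 K′<k′) ⟩
        1 + k′ * 4      ≤⟨ +-monoˡ-≤ (k′ * 4) (s≤s (z≤n {3})) ⟩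
        suc k′ * 4      ≡⟨ *-comm (suc k′) 4 ⟩
        4 * k           ∎
        where open ≤-Reasoning

  scale-by-addition : ∀ {A B T} → A ≢ B → T ≢ A → T ≢ B → 1 ≤ k′ → Scales A B T k′
  scale-by-addition {A} {B} {T} A≢B T≢A T≢B 1≤k′ =
    scaleBlock-correct Inv body 1≤k′ ≤-refl init (λ (rA , rB , _) → rA , rB)
    where
    Inv : ℕ → ℕ → ℕ → (Fin r → ℤ) → Set
    Inv a b j R = R A ≡ + (suc j * a) × R B ≡ + b × R T ≡ + a

    body : ∀ a b j {R} → Inv a b j R → Inv a b (suc j) (setReg R A (R A ℤ.+ R T))
    body a b j {R} (rA , rB , rT) =
      trans (setReg-same R A _) (trans (cong₂ ℤ._+_ rA rT) (cong +_ (+-comm (suc j * a) a))) ,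
      trans (setReg-other R _ A≢B) rB ,
      trans (setReg-other R _ (T≢A ∘ sym)) rT

    init : ∀ {a b R} → (A ↦ a ∧ B ↦ b) R → Inv a b 0 (setReg R T (R A ℤ.+ + 0))
    init {a} {R = R} (rA , rB) =
      trans (setReg-other R _ T≢A) (trans rA (cong +_ (sym (+-identityʳ a)))) ,
      trans (setReg-other R _ T≢B) rB ,
      trans (setReg-same R T _) (trans (ℤ.+-identityʳ (R A)) rA)

  scale-by-doubling : ∀ {A B} → A ≢ B → ∀ K → 1 ≤ K → k ≡ 2 ^ K → Scales A B A K
  scale-by-doubling {A} {B} A≢B K 1≤K k≡2ᴷ =
    scaleBlock-correct Inv body 1≤K (subst (K <_) (sym k≡2ᴷ) (n<2^n K)) init exit
    where
    Inv : ℕ → ℕ → ℕ → (Fin r → ℤ) → Set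
    Inv a b j R = R A ≡ + (2 ^ j * a) × R B ≡ + b

    twice : ∀ p a → p * a + p * a ≡ 2 * p * a
    twice = solve-∀

    body : ∀ a b j {R} → Inv a b j R → Inv a b (suc j) (setReg R A (R A ℤ.+ R A))
    body a b j {R} (rA , rB) =
      trans (setReg-same R A _) (trans (cong₂ ℤ._+_ rA rA) (cong +_ (twice (2 ^ j) a))) ,
      trans (setReg-other R _ A≢B) rB

    init : ∀ {a b R} → (A ↦ a ∧ B ↦ b) R → Inv a b 0 (setReg R A (R A ℤ.+ + 0))
    init {R = R} (rA , rB) =
      trans (setReg-same R A _) (cong (ℤ._+ + 0) rA) ,
      trans (setReg-other R _ A≢B) rB

    exit : ∀ {a b R} → Inv a b K R → (A ↦ k * a ∧ B ↦ b) R
    exit {a} (rA , rB) = trans rA (cong (λ p → + (p * a)) (sym k≡2ᴷ)) , rB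

module _ {a b : ℕ} where

  evalRel-le-true : a ≤ b → evalRel le (+ a) (+ b) ≡ true
  evalRel-le-true a≤b = dec-true (+ a ℤ.≤? + b) (ℤ.+≤+ a≤b)

  evalRel-le-false : ¬ a ≤ b → evalRel le (+ a) (+ b) ≡ false
  evalRel-le-false a≰b = dec-false (+ a ℤ.≤? + b) λ { (ℤ.+≤+ a≤b) → a≰b a≤b }

  evalRel-lt-true : a < b → evalRel lt (+ a) (+ b) ≡ true
  evalRel-lt-true a<b = dec-true (+ a ℤ.<? + b) (ℤ.+<+ a<b)

  evalRel-lt-false : ¬ a < b → evalRel lt (+ a) (+ b) ≡ false
  evalRel-lt-false a≮b = dec-false (+ a ℤ.<? + b) λ { (ℤ.+<+ a<b) → a≮b a<b }

  evalRel-eq-true : a ≡ b → evalRel eq (+ a) (+ b) ≡ true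
  evalRel-eq-true a≡b = dec-true (+ a ℤ.≟ + b) (cong +_ a≡b)

  evalRel-eq-false : a ≢ b → evalRel eq (+ a) (+ b) ≡ false
  evalRel-eq-false a≢b = dec-false (+ a ℤ.≟ + b) (a≢b ∘ ℤ.+-injective)

[+m+n]-[+m]≡+n : ∀ P y → + (P + y) ℤ.- + P ≡ + y
[+m+n]-[+m]≡+n P y = begin
  + (P + y) ℤ.- + P   ≡⟨ ℤ.[+m]-[+n]≡m⊖n (P + y) P ⟩
  (P + y) ℤ.⊖ P       ≡⟨ ℤ.⊖-≥ (m≤m+n P y) ⟩
  + (P + y ∸ P)       ≡⟨ cong +_ (m+n∸m≡n P y) ⟩
  + y                 ∎
  where open ≡-Reasoning

module Recognizer
  {k′ s′ : ℕ} (1<k : 1 < suc k′)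
  (q₀ : Fin (suc s′)) (δ′ : Fin (suc s′) → Fin (suc k′) → Fin (suc s′)) (accept : Fin (suc s′) → Bool)
  {r : ℕ} {X Y TX TY : Fin r} (X≢Y : X ≢ Y) {K : ℕ}
  (scale-X : Scaling.Scales (suc s′) k′ X Y TX K) (scale-Y′ : Scaling.Scales (suc s′) k′ Y X TY K)
  where

  open Control (suc s′) k′
  open Scaling (suc s′) k′ using (scaleBlock)

  automaton : DFA k
  automaton = record { states = suc s′ ; start = q₀ ; δ = δ′ ; final = accept }

  initialise transition : Fin (suc s′ * k) → Fin (suc s′ * k)
  initialise _ = Fin.combine q₀ Fin.zero
  transition w = Fin.combine (δ′ (state w) (counter w)) (counter w)

  accepting : Fin (suc s′ * k) → Bool
  accepting w = accept (state w)

  -- Line numbers: 0–9 set X = k n + 1 and Y = k²; 10–17 raise Y to k^(d+1);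
  -- 18–31 shift X by one digit and feed its leading digit to δ′; 32–36 output.
  program : Program r (suc s′ * k)
  program =
    fset initialise ∷ read X ∷ scaleBlock X TX K 2 ++
    addc X X (+ 1) ∷ const Y (+ (k ^ 2)) ∷ ifr X le Y 18 ∷ scaleBlock Y TY K 11 ++ goto 10 ∷
    scaleBlock X TX K 18 ++ ifr X eq Y 32 ∷ fset resetCounter ∷
    ifr X lt Y 30 ∷ sub X X Y ∷ fset incCounter ∷ goto 26 ∷
    fset transition ∷ goto 18 ∷
    fif accepting 35 ∷ const X (+ 0) ∷ goto 36 ∷ const X (+ 1) ∷ write X ∷ []

  open Runs program

  -- one digit costs a multiplication (at most 4k steps), at most k − 1
  -- subtractions (4 steps each) and a few tests and jumps
  U : ℕ
  U = 8 * k + 8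

  private variable
    a b x P : ℕ
    q : Fin (suc s′)
    c : Config r (suc s′ * k)
    R : Fin r → ℤ
    Rg : (Fin r → ℤ) → Set

  set-X : ∀ {v} → v ≡ + a → R Y ≡ + b → (X ↦ a ∧ Y ↦ b) (setReg R X v)
  set-X {R = R} v≡a rY = trans (setReg-same R X _) v≡a , trans (setReg-other R _ X≢Y) rY

  set-Y : ∀ {v} → v ≡ + b → R X ≡ + a → (X ↦ a ∧ Y ↦ b) (setReg R Y v)
  set-Y {R = R} v≡b rX = trans (setReg-other R _ (X≢Y ∘ sym)) rX , trans (setReg-same R Y _) v≡b

  compares : ∀ ρ {t} → evalRel ρ (+ a) (+ b) ≡ t → (X ↦ a ∧ Y ↦ b) R → evalRel ρ (R X) (R Y) ≡ t
  compares ρ test (rX , rY) = trans (cong₂ (evalRel ρ) rX rY) test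

  scale-Y : ∀ {ℓ o} → Contains program ℓ (scaleBlock Y TY K ℓ) →
            At ℓ (X ↦ a ∧ Y ↦ b) (InState q) o c → Reach c (4 * k) (At (6 + ℓ) (X ↦ a ∧ Y ↦ k * b) (InState q) o)
  scale-Y contains now = Reach-map (At-map ↦-swap id) (scale-Y′ contains (At-map ↦-swap id now))

  within-U : ∀ {c} → c ≤ 4 * k + 8 → 4 * k + c ≤ U
  within-U {c} c≤ = ≤-trans (+-monoʳ-≤ (4 * k) c≤) (≤-reflexive (split k))
    where
    split : ∀ k → 4 * k + (4 * k + 8) ≡ 8 * k + 8
    split = solve-∀

  scaled-input : ∀ n → Reach (initial (+ n)) U (At 10 (X ↦ k * n + 1 ∧ Y ↦ k ^ 2) (InState q₀) [])
  scaled-input n = Reach-weaken bound (refl ⟫ refl ⟫ (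
    scale-X (_ , refl) (mkAt refl (set-X refl refl) (inState (state-combine q₀ Fin.zero)) refl refl) ⨾ λ now →
    addc-step {Rg′ = X ↦ k * n + 1 ∧ Y ↦ 0} refl (λ (rX , rY) → set-X (cong (ℤ._+ + 1) rX) rY) now ⨾ λ now →
    const-step refl (λ (rX , _) → set-Y refl rX) now))
    where
    bound : 2 + (4 * k + 2) ≤ U
    bound = ≤-trans (≤-reflexive (regroup k)) (within-U (≤-trans (m≤m+n 4 4) (m≤n+m 8 (4 * k))))
      where
      regroup : ∀ k → 2 + (4 * k + 2) ≡ 4 * k + 4
      regroup = solve-∀

  module _ {n d : ℕ} (n<kᵈ : n < k ^ d) (least : ∀ e → 1 ≤ e → n < k ^ e → d ≤ e) where

    power-loop : ∀ m e → e + m ≡ d → 1 ≤ e →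
      At 10 (X ↦ k * n + 1 ∧ Y ↦ k ^ suc e) (InState q) [] c →
      Reach c (suc m * U) (At 18 (X ↦ k * n + 1 ∧ Y ↦ k ^ suc d) (InState q) [])
    power-loop {q} {c} zero e e+0≡d _ now =
      Reach-weaken (m≤m+n 1 _)
        (subst (λ e → Reach c 1 (At 18 (X ↦ k * n + 1 ∧ Y ↦ k ^ suc e) (InState q) [])) e≡d
          (ifr-step refl (compares le (evalRel-le-true fits)) now))
      where
      e≡d : e ≡ d
      e≡d = trans (sym (+-identityʳ e)) e+0≡d
      n<kᵉ : n < k ^ e
      n<kᵉ = subst (λ e → n < k ^ e) (sym e≡d) n<kᵈ
      fits : k * n + 1 ≤ k * k ^ e
      fits = subst (_≤ k * k ^ e) (+-comm 1 (k * n)) (*-monoʳ-< k n<kᵉ)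
    power-loop (suc m) e e+1+m≡d 1≤e now =
      Reach-weaken (bound (suc m * U)) (
      ifr-step refl (compares le (evalRel-le-false overflows)) now ⨾ λ now →
      scale-Y (_ , refl) now ⨾ λ now →
      goto-step refl now ⨾ λ now →
      power-loop m (suc e) (trans (sym (+-suc e m)) e+1+m≡d) (s≤s z≤n) now)
      where
      kᵉ≤n : k ^ e ≤ n
      kᵉ≤n = ≮⇒≥ λ n<kᵉ → <⇒≱ (subst (e <_) e+1+m≡d (m<m+n e z<s)) (least e 1≤e n<kᵉ)
      overflows : ¬ k * n + 1 ≤ k * k ^ e
      overflows fits = <⇒≱ (subst (k * n <_) (+-comm 1 (k * n)) (n<1+n (k * n))) (≤-trans fits (*-monoʳ-≤ k kᵉ≤n))
      bound : ∀ R → 1 + (4 * k + (1 + R)) ≤ U + R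
      bound R = ≤-trans (≤-reflexive (regroup k R)) (+-monoˡ-≤ R (within-U (≤-trans (m≤m+n 2 6) (m≤n+m 8 (4 * k)))))
        where
        regroup : ∀ k R → 1 + (4 * k + (1 + R)) ≡ 4 * k + 2 + R
        regroup = solve-∀

  subtraction-loop : ∀ cnt j → x < P → cnt + j < k →
    At 26 (X ↦ cnt * P + x ∧ Y ↦ P) (Counting q j) [] c →
    Reach c (1 + cnt * 4) (At 30 (X ↦ x ∧ Y ↦ P) (Counting q (cnt + j)) [])
  subtraction-loop zero j x<P _ now =
    ifr-step refl (compares lt (evalRel-lt-true x<P)) now ⨾ λ now → stay now
  subtraction-loop {x} {P} (suc cnt) j x<P cnt+j<k now =
    ifr-step refl (compares lt (evalRel-lt-false (≤⇒≯ P≤X))) now ⨾ λ now →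
    sub-step refl (λ (rX , rY) → set-X (trans (cong₂ ℤ._-_ rX rY) subtracted) rY) now ⨾ λ now →
    fset-step refl (incCounter-Counting (≤-<-trans (s≤s (m≤n+m j cnt)) cnt+j<k)) now ⨾ λ now →
    goto-step refl now ⨾ λ now →
    Reach-map (At-map id λ (counting s≡q counted) → counting s≡q (trans counted (+-suc cnt j)))
      (subtraction-loop cnt (suc j) x<P (subst (_< k) (sym (+-suc cnt j)) cnt+j<k) now)
    where
    P≤X : P ≤ suc cnt * P + x
    P≤X = ≤-trans (m≤m+n P (cnt * P)) (m≤m+n (suc cnt * P) x)
    subtracted : + (suc cnt * P + x) ℤ.- + P ≡ + (cnt * P + x)
    subtracted = trans (cong (λ z → + z ℤ.- + P) (+-assoc P (cnt * P) x)) ([+m+n]-[+m]≡+n P (cnt * P + x))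

  digits-loop : ∀ v i → k ^ (length v + suc i) ≡ P →
    At 18 (X ↦ marked v i ∧ Y ↦ P) (InState q) [] c →
    Reach c (suc (length v) * U) (At 32 (X ↦ P ∧ Y ↦ P) (InState (run automaton q v)) [])
  digits-loop [] i kⁱ⁺¹≡P now =
    Reach-weaken bound (
    scale-X (_ , refl) now ⨾ λ now →
    ifr-step refl (compares eq (evalRel-eq-true kⁱ⁺¹≡P)) now ⨾ λ now →
    stay (At-map (λ (rX , rY) → trans rX (cong +_ kⁱ⁺¹≡P) , rY) id now))
    where
    bound : 4 * k + (1 + 0) ≤ U + 0
    bound = ≤-trans (within-U (≤-trans (m≤m+n 1 7) (m≤n+m 8 (4 * k)))) (m≤m+n U 0)
  digits-loop {P} {q} (a ∷ v) i kˡ⁺ⁱ≡P now =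
    Reach-weaken (bound (toℕ<n a) (suc (length v) * U)) (
    scale-X (_ , refl) now ⨾ λ now →
    ifr-step refl (compares eq (evalRel-eq-false kX≢P)) now ⨾ λ now →
    fset-step refl resetCounter-Counting now ⨾ λ now →
    subtraction-loop (toℕ a) 0 x′<P (subst (_< k) (sym (+-identityʳ (toℕ a))) (toℕ<n a))
      (At-map (λ (rX , rY) → trans rX (cong +_ kX≡) , rY) id now) ⨾ λ now →
    fset-step refl reads-digit now ⨾ λ now →
    goto-step refl now ⨾ λ now →
    digits-loop v (suc i) kˡ⁺ⁱ⁺¹≡P now)
    where
    kˡ⁺ⁱ⁺¹≡P : k ^ (length v + suc (suc i)) ≡ P
    kˡ⁺ⁱ⁺¹≡P = trans (cong (k ^_) (+-suc (length v) (suc i))) kˡ⁺ⁱ≡P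
    x′ : ℕ
    x′ = marked v (suc i)
    kX≡ : k * marked (a ∷ v) i ≡ toℕ a * P + x′
    kX≡ = trans (*-marked-∷ a v i) (cong (λ p → toℕ a * p + x′) kˡ⁺ⁱ⁺¹≡P)
    x′<P : x′ < P
    x′<P = subst (x′ <_) kˡ⁺ⁱ⁺¹≡P (marked-< 1<k v (suc i))
    kX≢P : k * marked (a ∷ v) i ≢ P
    kX≢P kX≡P = m*n+o≢n (toℕ a) (≤-trans (m^n>0 k (suc i)) (m≤n+m (k ^ suc i) (value v * k ^ suc (suc i)))) x′<P (trans (sym kX≡) kX≡P)
    reads-digit : ∀ {w} → Counting q (toℕ a + 0) w → InState (δ′ q a) (transition w)
    reads-digit {w} (counting refl counted) =
      inState (trans (state-combine _ (counter w))
                     (cong (δ′ (state w)) (toℕ-injective (trans counted (+-identityʳ (toℕ a))))))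
    bound : toℕ a < k → ∀ R → 4 * k + (1 + (1 + ((1 + toℕ a * 4) + (1 + (1 + R))))) ≤ U + R
    bound a<k R = ≤-trans (≤-reflexive (regroup k (toℕ a) R)) (+-monoˡ-≤ R (within-U digit-cost))
      where
      regroup : ∀ k a R → 4 * k + (1 + (1 + ((1 + a * 4) + (1 + (1 + R))))) ≡ 4 * k + (5 + a * 4) + R
      regroup = solve-∀
      digit-cost : 5 + toℕ a * 4 ≤ 4 * k + 8
      digit-cost = begin
        5 + toℕ a * 4   ≤⟨ +-mono-≤ (m≤m+n 5 3) (*-monoˡ-≤ 4 (<⇒≤ a<k)) ⟩
        8 + k * 4       ≡⟨ cong (λ z → 8 + z) (*-comm k 4) ⟩
        8 + 4 * k       ≡⟨ +-comm 8 (4 * k) ⟩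
        4 * k + 8       ∎
        where open ≤-Reasoning

  verdict : Bool → ℤ
  verdict true  = + 1
  verdict false = + 0

  Done : List ℤ → Config r (suc s′ * k) → Set
  Done out c = Halted program c × output c ≡ out

  finish : ∀ {o} → At 37 Rg (InState q) o c → Reach c 0 (Done o)
  finish {c = cfg _ _ _ _ _} (mkAt refl _ _ _ refl) = stay (refl , refl)

  outputs-verdict : At 32 Rg (InState q) [] c → Reach c 4 (Done [ verdict (accept q) ])
  outputs-verdict {q = q} now with accept q in accepted
  ... | true = Reach-weaken (n≤1+n 3) (
    fif-step refl (λ (inState s≡q) → trans (cong accept s≡q) accepted) now ⨾ λ now →
    const-step {Rg′ = λ R → R X ≡ + 1} refl (λ {R} _ → setReg-same R X _) now ⨾ λ now →
    write-step refl id now ⨾ λ now →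
    finish now)
  ... | false =
    fif-step refl (λ (inState s≡q) → trans (cong accept s≡q) accepted) now ⨾ λ now →
    const-step {Rg′ = λ R → R X ≡ + 0} refl (λ {R} _ → setReg-same R X _) now ⨾ λ now →
    goto-step refl now ⨾ λ now →
    write-step refl id now ⨾ λ now →
    finish now

  module _ (h : 2 ≤ k) (n : ℕ) where
    private
      w : List (Fin k)
      w = kary k h n
      d : ℕ
      d = length w

    recognizes : Reach (initial (+ n)) (5 * U * d) (Done [ verdict (accept (run automaton q₀ w)) ])
    recognizes = Reach-weaken (total-bound d (length-kary-positive h n)) (
      scaled-input n ⨾ λ now →
      power-loop n<kᵈ (length-kary-minimal h n) (d ∸ 1) 1 (m+[n∸m]≡n (length-kary-positive h n)) (s≤s z≤n) now ⨾ λ now →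
      digits-loop w 0 (cong (k ^_) (+-comm d 1)) (At-map (λ (rX , rY) → trans rX (cong +_ scaled≡marked) , rY) id now) ⨾ λ now →
      outputs-verdict now)
      where
      n<kᵈ : n < k ^ d
      n<kᵈ = subst (_< k ^ d) (value-kary h n) (value-< w)
      scaled≡marked : k * n + 1 ≡ marked w 0
      scaled≡marked = cong (_+ 1) (trans (*-comm k n) (cong₂ _*_ (sym (value-kary h n)) (sym (*-identityʳ k))))
      total-bound : ∀ d → 1 ≤ d → U + (suc (d ∸ 1) * U + (suc d * U + 4)) ≤ 5 * U * d
      total-bound (suc d′) _ = begin
        U + (suc d′ * U + (suc (suc d′) * U + 4))
          ≤⟨ +-monoʳ-≤ U (+-monoʳ-≤ (suc d′ * U) (+-monoʳ-≤ (suc (suc d′) * U) 4≤U)) ⟩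
        U + (suc d′ * U + (suc (suc d′) * U + U))
          ≤⟨ m≤m+n _ (3 * d′ * U) ⟩
        U + (suc d′ * U + (suc (suc d′) * U + U)) + 3 * d′ * U
          ≡⟨ regroup U d′ ⟨
        5 * U * suc d′
          ∎
        where
        open ≤-Reasoning
        4≤U : 4 ≤ U
        4≤U = ≤-trans (m≤m+n 4 4) (m≤n+m 8 (8 * k))
        regroup : ∀ U d′ → 5 * U * suc d′ ≡ U + (suc d′ * U + (suc (suc d′) * U + U)) + 3 * d′ * U
        regroup = solve-∀

  decides : (L : List (Fin k) → Set) → (∀ w → L w ⇔ Accepts automaton w) → (h : 2 ≤ k) → DecidesLinear r k h L
  decides L L⇔ h = k′ + s′ * k , program , 5 * U , λ n →
    let (t , c , t≤ , runs , halted , written) = recognizes h n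
        q = run automaton q₀ (kary k h n)
    in t , _ , t≤ , (c , runs , halted , written) , accepted q (L⇔ (kary k h n)) , rejected q (L⇔ (kary k h n))
    where
    accepted : ∀ {A : Set} q → A ⇔ (accept q ≡ true) → A → [ verdict (accept q) ] ≡ [ + 1 ]
    accepted q A⇔ a rewrite Equivalence.to A⇔ a = refl
    rejected : ∀ {A : Set} q → A ⇔ (accept q ≡ true) → ¬ A → [ verdict (accept q) ] ≡ [ + 0 ]
    rejected q A⇔ ¬a with accept q
    ... | true  = contradiction (Equivalence.from A⇔ refl) ¬a
    ... | false = refl

theorem13 : (k : ℕ) (h : 2 ≤ k) (L : List (Fin k) → Set) → Regular L →
    DecidesLinear 3 k h L × (IsPowerOfTwo k → DecidesLinear 2 k h L)
theorem13 (suc k′) _ L (record { states = zero ; start = () } , _)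
theorem13 (suc k′) h@(s≤s 1≤k′) L (record { states = suc s′ ; start = q₀ ; δ = δ′ ; final = accept } , L⇔) =
  three-registers , two-registers
  where
  open Scaling (suc s′) k′

  three-registers : DecidesLinear 3 (suc k′) h L
  three-registers =
    Recognizer.decides h q₀ δ′ accept {X = zero} {Y = suc zero} {TX = suc (suc zero)} {TY = suc (suc zero)} (λ ())
      (scale-by-addition (λ ()) (λ ()) (λ ()) 1≤k′) (scale-by-addition (λ ()) (λ ()) (λ ()) 1≤k′) L L⇔ h

  two-registers : IsPowerOfTwo (suc k′) → DecidesLinear 2 (suc k′) h L
  two-registers (zero , k≡1) = contradiction (subst (1 ≤_) (suc-injective k≡1) 1≤k′) λ ()
  two-registers (suc K , k≡2ᴷ) =
    Recognizer.decides h q₀ δ′ accept {X = zero} {Y = suc zero} (λ ())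
      (scale-by-doubling (λ ()) (suc K) (s≤s z≤n) k≡2ᴷ) (scale-by-doubling (λ ()) (suc K) (s≤s z≤n) k≡2ᴷ) L L⇔ h
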